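{- Let $t=k_1\cdot x_1+\dots+k_r\cdot x_r$ be a homogeneous term, $c\in\mathbb Z$, $\bowtie\in\{=,\neq,<,\leq,>,\geq\}$, and let $m<n$ be integers with $m$ small and $n$ large (for $t$ and $c$). Then the DWA $\mathcal A^{t\bowtie c}_{(m,n)}$ represents $\{\bar a\in\mathbb Z^r: t[\bar a]\bowtie c\}$, and it has $2+n-m$ states.
   Context: Fix an integer base $\varrho\geq2$ and $\Sigma=\{0,\dots,\varrho-1\}$. A homogeneous term is $0$ or $k_1\cdot x_1+\dots+k_r\cdot x_r$ with distinct variables and nonzero integer $k_i$; $t[\bar a]=\sum k_ia_i$; $\|t\|_-=\sum_{k_j<0}|k_j|$, $\|t\|_+=\sum_{k_j>0}k_j$. An integer $q$ is small if $q<\min\{c,-\|t\|_+\}$ and large if $q>\max\{c,\|t\|_-\}$. A letter $\bar b=(b_1,\dots,b_r)\in\Sigma^r$ is identified with the tuple $(b_1,\dots,b_r)$, and $\sigma(\bar b)=(c_1,\dots,c_r)$ with $c_i=0$ if $b_i=0$, $c_i=-1$ otherwise. Let $\eta(q_I,\bar b)=t[\sigma(\bar b)]$ and $\eta(q,\bar b)=\varrho q+t[\bar b]$ for $q\in\mathbb Z$. The DWA $\mathcal A^{t\bowtie c}_{(m,n)}=(Q,\Sigma^r,\delta,q_I,F)$ has states $Q=\{q_I\}\cup\{q\in\mathbb Z:m\leq q\leq n\}$ ($q_I$ a new initial state), transitions $\delta(q,\bar b)=m$ if $\eta(q,\bar b)\leq m$, $=n$ if $\eta(q,\bar b)\geq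 n$, and $=\eta(q,\bar b)$ otherwise, and accepting states $F=\{q\in Q\cap\mathbb Z: q\bowtie c\}$. Encoding: for $b_nb_{n-1}\dots b_0\in\Sigma^+$, $\langle b_n\dots b_0\rangle_{\mathbb Z}=\sum_{i<n}\varrho^ib_i$ if $b_n=0$ and $\sum_{i<n}\varrho^ib_i-\varrho^n$ otherwise; words over $\Sigma^r$ are decoded track by track. A DWA over $\Sigma^r$ represents $U\subseteq\mathbb Z^r$ if its language is $\{w\in(\Sigma^r)^+:\langle w\rangle_{\mathbb Z}\in U\}$. -}

module Defs where

open import Data.Nat as ℕ using (ℕ; zero; suc)
open import Data.Fin using (Fin; toℕ)
open import Data.Integer as ℤ using (ℤ; +_; -_; _+_; _*_; _≤_; _<_; _⊓_; _⊔_; _≤?_; 0ℤ; -1ℤ)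
open import Data.Integer.Properties using (≰⇒>)
open import Data.Vec using (Vec; []; _∷_; lookup; map; zipWith; foldr)
open import Data.List using (List; []; _∷_; foldl; length)
open import Data.List.NonEmpty using (List⁺; _∷_)
import Data.List.NonEmpty as L⁺
open import Data.Empty using (⊥)
open import Data.Unit using (⊤)
open import Relation.Binary.PropositionalEquality using (_≡_; _≢_; refl)
open import Relation.Nullary using (yes; no)
open import Function.Bundles using (_⇔_)

Digit : ℕ → Set
Digit ρ = Fin ρ

Letter : ℕ → ℕ → Set
Letter ρ r = Vec (Fin ρ) r

-- Homogeneous terms  t = k₁x₁ + … + k_r x_r  (coefficient vector;
-- nonzeroness of the coefficients is a hypothesis of the theorem;
-- r = 0 gives the term 0).

Term : ℕ → Set
Term r = Vec ℤ r

sumℤ : ∀ {r} → Vec ℤ r → ℤ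
sumℤ = foldr _ _+_ 0ℤ

eval : ∀ {r} → Term r → Vec ℤ r → ℤ
eval k a = sumℤ (zipWith _*_ k a)

negPart : ℤ → ℤ
negPart k = - (k ⊓ 0ℤ)

posPart : ℤ → ℤ
posPart k = k ⊔ 0ℤ

norm₋ : ∀ {r} → Term r → ℤ
norm₋ k = sumℤ (map negPart k)

norm₊ : ∀ {r} → Term r → ℤ
norm₊ k = sumℤ (map posPart k)

Small : ∀ {r} → Term r → ℤ → ℤ → Set
Small t c q = q < (c ⊓ (- norm₊ t))

Large : ∀ {r} → Term r → ℤ → ℤ → Set
Large t c q = (c ⊔ norm₋ t) < q

data Cmp : Set where
  EQ NE LT LE GT GE : Cmp

⟦_⟧ : Cmp → ℤ → ℤ → Set
⟦ EQ ⟧ x y = x ≡ y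
⟦ NE ⟧ x y = x ≢ y
⟦ LT ⟧ x y = x < y
⟦ LE ⟧ x y = x ≤ y
⟦ GT ⟧ x y = y < x
⟦ GE ⟧ x y = y ≤ x

record DWA (A : Set) : Set₁ where
  field
    Q      : Set
    δ      : Q → A → Q
    qI     : Q
    Accept : Q → Set

  δ* : Q → List A → Q
  δ* = foldl δ

  -- word read left to right (most significant letter first)
  Accepts : List⁺ A → Set
  Accepts (a ∷ w) = Accept (δ* (δ qI a) w)

-- Decoding (two's-complement-like, most significant digit first)

valℕ : ∀ {ρ} → List (Fin ρ) → ℕ
valℕ {ρ} = foldl (λ acc b → ρ ℕ.* acc ℕ.+ toℕ b) 0

decodeTrack : ∀ {ρ} → List⁺ (Fin ρ) → ℤ
decodeTrack {ρ} (bn ∷ bs) with toℕ bn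
... | zero  = + valℕ bs
... | suc _ = + valℕ bs ℤ.- + (ρ ℕ.^ length bs)

decode : ∀ {ρ r} → List⁺ (Letter ρ r) → Vec ℤ r
decode {ρ} {r} w = Data.Vec.tabulate (λ i → decodeTrack (L⁺.map (λ b → lookup b i) w))

Represents : ∀ {ρ r} → DWA (Letter ρ r) → (Vec ℤ r → Set) → Set
Represents {ρ} {r} A U = (w : List⁺ (Letter ρ r)) → DWA.Accepts A w ⇔ U (decode w)

data State (m n : ℤ) : Set where
  qInit : State m n
  val   : (q : ℤ) → m ≤ q → q ≤ n → State m n

σ : ∀ {ρ r} → Letter ρ r → Vec ℤ r
σ = map (λ b → sigma1 (toℕ b))
  where
  sigma1 : ℕ → ℤ
  sigma1 zero    = 0ℤ
  sigma1 (suc _) = -1ℤ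

η : ∀ {ρ r m n} → Term r → State m n → Letter ρ r → ℤ
η t qInit       b = eval t (σ b)
η {ρ} t (val q _ _) b = + ρ * q + eval t (map (λ d → + toℕ d) b)

clamp : ∀ {m n} → m ≤ n → ℤ → State m n
clamp {m} {n} m≤n e with e ≤? m
... | yes _   = val m Data.Integer.Properties.≤-refl m≤n
... | no e≰m with n ≤? e
...   | yes _   = val n m≤n Data.Integer.Properties.≤-refl
...   | no n≰e  = val e (Data.Integer.Properties.<⇒≤ (≰⇒> e≰m))
                        (Data.Integer.Properties.<⇒≤ (≰⇒> n≰e))

acceptSt : ∀ {m n} → Cmp → ℤ → State m n → Set
acceptSt ⋈ c qInit       = ⊥
acceptSt ⋈ c (val q _ _) = ⟦ ⋈ ⟧ q c

automaton : (ρ : ℕ) {r : ℕ} → Term r → Cmp → ℤ → (m n : ℤ) → m ≤ n → DWA (Letter ρ r)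
automaton ρ t ⋈ c m n m≤n = record
  { Q      = State m n
  ; δ      = λ q b → clamp m≤n (η t q b)
  ; qI     = qInit
  ; Accept = acceptSt ⋈ c
  }

{-# OPTIONS --safe #-}
module Submission where

-- Read as two's-complement numerals, the tracks of a word give a value v = t[ā] computed by
-- Horner's scheme: the leading letter b̄ contributes t[σ(b̄)], and each further letter b̄
-- maps v to ρv + t[b̄]. The state of the automaton is v as long as v stays in [m, n], and is
-- stuck at m (resp. n) once v has left it downwards (upwards): for small m, v ≤ m gives
-- ρv + t[b̄] ≤ ρm + (ρ - 1)‖t‖₊ = m + (ρ - 1)(m + ‖t‖₊) ≤ m, and symmetrically for large n.
-- Since m < c < n, the stuck states decide v ⋈ c correctly.

open import Defs
open import Data.Nat as ℕ using (ℕ; zero; suc; s≤s; _^_; _≥_)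
open import Data.Fin using (Fin; toℕ; fromℕ<) renaming (zero to fzero; suc to fsuc)
import Data.Fin.Properties as FinP
open import Data.Integer
  using (ℤ; +_; -_; _+_; _-_; _*_; _≤_; _<_; _⊓_; _≤?_; ∣_∣; 0ℤ; -1ℤ; +≤+; nonNegative; nonPositive)
open import Data.Integer.Properties using (<⇒≤)
import Data.Integer.Properties as ℤP
open import Data.Integer.Solver using (module +-*-Solver)
open +-*-Solver using (solve; _:+_; _:*_; :-_; _:=_; con)
open import Data.List using (List; []; _∷_; foldl; length)
import Data.List as List
import Data.List.Properties as ListP
open import Data.List.NonEmpty using (_∷_)
open import Data.Vec using (Vec; []; _∷_; lookup; map; zipWith)
import Data.Vec.Properties as VecP
open import Data.Vec.Relation.Unary.All using (All)
open import Data.Product using (_×_; _,_)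
open import Relation.Binary.PropositionalEquality
open import Relation.Nullary using (¬_; yes; no; contradiction)
open import Function.Base using (id)
open import Function.Bundles using (_⇔_; _↔_; mk⇔; mk↔ₛ′)

foldl-fusion : ∀ {A B C : Set} (h : A → C) {f : A → B → A} {g : C → B → C} →
  (∀ x y → h (f x y) ≡ g (h x) y) → ∀ x xs → h (foldl f x xs) ≡ foldl g (h x) xs
foldl-fusion h         fuse x []       = refl
foldl-fusion h {g = g} fuse x (y ∷ ys) =
  trans (foldl-fusion h fuse _ ys) (cong (λ z → foldl g z ys) (fuse x y))

foldl-simulation : ∀ {A B C : Set} (R : A → C → Set) {f : A → B → A} {g : C → B → C} →
  (∀ {x z} y → R x z → R (f x y) (g z y)) → ∀ {x z} ys → R x z → R (foldl f x ys) (foldl g z ys)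
foldl-simulation R step []       xRz = xRz
foldl-simulation R step (y ∷ ys) xRz = foldl-simulation R step ys (step y xRz)

both : ∀ {P Q : Set} → P → Q → P ⇔ Q
both p q = mk⇔ (λ _ → q) (λ _ → p)

neither : ∀ {P Q : Set} → ¬ P → ¬ Q → P ⇔ Q
neither ¬p ¬q = mk⇔ (λ p → contradiction p ¬p) (λ q → contradiction q ¬q)

⟦⟧-below : ∀ ⋈ {x y c} → x < c → y < c → ⟦ ⋈ ⟧ x c ⇔ ⟦ ⋈ ⟧ y c
⟦⟧-below EQ x<c y<c = neither (ℤP.<⇒≢ x<c) (ℤP.<⇒≢ y<c)
⟦⟧-below NE x<c y<c = both (ℤP.<⇒≢ x<c) (ℤP.<⇒≢ y<c)
⟦⟧-below LT x<c y<c = both x<c y<c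
⟦⟧-below LE x<c y<c = both (<⇒≤ x<c) (<⇒≤ y<c)
⟦⟧-below GT x<c y<c = neither (ℤP.<-asym x<c) (ℤP.<-asym y<c)
⟦⟧-below GE x<c y<c = neither (ℤP.<⇒≱ x<c) (ℤP.<⇒≱ y<c)

⟦⟧-above : ∀ ⋈ {x y c} → c < x → c < y → ⟦ ⋈ ⟧ x c ⇔ ⟦ ⋈ ⟧ y c
⟦⟧-above EQ c<x c<y = neither (≢-sym (ℤP.<⇒≢ c<x)) (≢-sym (ℤP.<⇒≢ c<y))
⟦⟧-above NE c<x c<y = both (≢-sym (ℤP.<⇒≢ c<x)) (≢-sym (ℤP.<⇒≢ c<y))
⟦⟧-above LT c<x c<y = neither (ℤP.<-asym c<x) (ℤP.<-asym c<y)
⟦⟧-above LE c<x c<y = neither (ℤP.<⇒≱ c<x) (ℤP.<⇒≱ c<y)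
⟦⟧-above GT c<x c<y = both c<x c<y
⟦⟧-above GE c<x c<y = both (<⇒≤ c<x) (<⇒≤ c<y)

small⇒<c : ∀ {r} (t : Term r) {c m} → Small t c m → m < c
small⇒<c t {c} small = ℤP.<-≤-trans small (ℤP.i⊓j≤i c _)

small⇒+norm₊≤0 : ∀ {r} (t : Term r) {c m} → Small t c m → m + norm₊ t ≤ 0ℤ
small⇒+norm₊≤0 t {c} {m} small = begin
  m + norm₊ t           ≤⟨ ℤP.+-monoˡ-≤ (norm₊ t) (<⇒≤ (ℤP.<-≤-trans small (ℤP.i⊓j≤j c _))) ⟩
  - norm₊ t + norm₊ t   ≡⟨ ℤP.+-inverseˡ (norm₊ t) ⟩
  0ℤ                    ∎
  where open ℤP.≤-Reasoning

large⇒c< : ∀ {r} (t : Term r) {c n} → Large t c n → c < n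
large⇒c< t {c} large = ℤP.≤-<-trans (ℤP.i≤i⊔j c (norm₋ t)) large

large⇒0≤-norm₋ : ∀ {r} (t : Term r) {c n} → Large t c n → 0ℤ ≤ n - norm₋ t
large⇒0≤-norm₋ t {c} large = ℤP.i≤j⇒0≤j-i (<⇒≤ (ℤP.≤-<-trans (ℤP.i≤j⊔i c (norm₋ t)) large))

module _ (p : ℕ) where

  private
    ρ : ℕ
    ρ = suc p

  digits : ∀ {r} → Letter ρ r → Vec ℤ r
  digits = map (λ d → + toℕ d)

  d≤p : (d : Fin ρ) → + toℕ d ≤ + p
  d≤p d = +≤+ (FinP.toℕ≤pred[n] d)

  *-digit-≤ : ∀ k (d : Fin ρ) → k * + toℕ d ≤ + p * posPart k
  *-digit-≤ k d = begin
    k * + toℕ d           ≤⟨ ℤP.*-monoʳ-≤-nonNeg (+ toℕ d) (ℤP.i≤i⊔j k 0ℤ) ⟩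
    posPart k * + toℕ d   ≤⟨ ℤP.*-monoˡ-≤-nonNeg (posPart k) {{nonNegative (ℤP.i≤j⊔i k 0ℤ)}} (d≤p d) ⟩
    posPart k * + p       ≡⟨ ℤP.*-comm (posPart k) (+ p) ⟩
    + p * posPart k       ∎
    where open ℤP.≤-Reasoning

  *-digit-≥ : ∀ k (d : Fin ρ) → - (+ p * negPart k) ≤ k * + toℕ d
  *-digit-≥ k d = begin
    - (+ p * negPart k)   ≡⟨ solve 2 (λ P K → :- (P :* (:- K)) := K :* P) refl (+ p) (k ⊓ 0ℤ) ⟩
    (k ⊓ 0ℤ) * + p        ≤⟨ ℤP.*-monoˡ-≤-nonPos (k ⊓ 0ℤ) {{nonPositive (ℤP.i⊓j≤j k 0ℤ)}} (d≤p d) ⟩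
    (k ⊓ 0ℤ) * + toℕ d    ≤⟨ ℤP.*-monoʳ-≤-nonNeg (+ toℕ d) (ℤP.i⊓j≤i k 0ℤ) ⟩
    k * + toℕ d           ∎
    where open ℤP.≤-Reasoning

  eval-digits-≤ : ∀ {r} (t : Term r) (b : Letter ρ r) → eval t (digits b) ≤ + p * norm₊ t
  eval-digits-≤ []      []      = ℤP.≤-reflexive (sym (ℤP.*-zeroʳ (+ p)))
  eval-digits-≤ (k ∷ t) (d ∷ b) = ℤP.≤-trans
    (ℤP.+-mono-≤ (*-digit-≤ k d) (eval-digits-≤ t b))
    (ℤP.≤-reflexive (sym (ℤP.*-distribˡ-+ (+ p) (posPart k) (norm₊ t))))

  eval-digits-≥ : ∀ {r} (t : Term r) (b : Letter ρ r) → - (+ p * norm₋ t) ≤ eval t (digits b)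
  eval-digits-≥ []      []      = ℤP.≤-reflexive (cong -_ (ℤP.*-zeroʳ (+ p)))
  eval-digits-≥ (k ∷ t) (d ∷ b) = ℤP.≤-trans
    (ℤP.≤-reflexive (solve 3 (λ P K N → :- (P :* (K :+ N)) := :- (P :* K) :+ :- (P :* N)) refl
                       (+ p) (negPart k) (norm₋ t)))
    (ℤP.+-mono-≤ (*-digit-≥ k d) (eval-digits-≥ t b))

  pushDigit : ℤ → Fin ρ → ℤ
  pushDigit a d = + ρ * a + + toℕ d

  horner : ℤ → List (Fin ρ) → ℤ
  horner = foldl pushDigit

  valℕ≡horner : ∀ ds → + valℕ ds ≡ horner 0ℤ ds
  valℕ≡horner = foldl-fusion +_ (λ a d →
    trans (ℤP.pos-+ (ρ ℕ.* a) (toℕ d)) (cong (_+ + toℕ d) (ℤP.pos-* ρ a))) 0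

  horner-+ : ∀ a b ds → horner (a + b) ds ≡ a * + (ρ ^ length ds) + horner b ds
  horner-+ a b []       = cong (_+ b) (sym (ℤP.*-identityʳ a))
  horner-+ a b (d ∷ ds) = begin
    horner (+ ρ * (a + b) + + toℕ d) ds
      ≡⟨ cong (λ z → horner z ds) (solve 4 (λ R a b d → R :* (a :+ b) :+ d := R :* a :+ (R :* b :+ d))
                                      refl (+ ρ) a b (+ toℕ d)) ⟩
    horner (+ ρ * a + (+ ρ * b + + toℕ d)) ds
      ≡⟨ horner-+ (+ ρ * a) _ ds ⟩
    + ρ * a * + (ρ ^ length ds) + horner (+ ρ * b + + toℕ d) ds
      ≡⟨ cong (_+ horner (+ ρ * b + + toℕ d) ds) ρ-shift ⟩
    a * + (ρ ^ suc (length ds)) + horner (+ ρ * b + + toℕ d) ds ∎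
    where
    open ≡-Reasoning
    ρ-shift : + ρ * a * + (ρ ^ length ds) ≡ a * + (ρ ^ suc (length ds))
    ρ-shift = trans (solve 3 (λ R a X → R :* a :* X := a :* (R :* X)) refl (+ ρ) a (+ (ρ ^ length ds)))
                    (cong (a *_) (sym (ℤP.pos-* ρ (ρ ^ length ds))))

  decodeTrack≡horner : ∀ {r} (a : Letter ρ r) i ds →
    decodeTrack (lookup a i ∷ ds) ≡ horner (lookup (σ a) i) ds
  decodeTrack≡horner (d ∷ a) (fsuc i) ds = decodeTrack≡horner a i ds
  decodeTrack≡horner (d ∷ a) fzero    ds with toℕ d
  ... | zero  = valℕ≡horner ds
  ... | suc _ = begin
    + valℕ ds - + (ρ ^ length ds)            ≡⟨ cong (_- + (ρ ^ length ds)) (valℕ≡horner ds) ⟩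
    horner 0ℤ ds - + (ρ ^ length ds)         ≡⟨ solve 2 (λ X H → H :+ :- X := con -1ℤ :* X :+ H)
                                                  refl (+ (ρ ^ length ds)) _ ⟩
    -1ℤ * + (ρ ^ length ds) + horner 0ℤ ds   ≡⟨ sym (horner-+ -1ℤ 0ℤ ds) ⟩
    horner -1ℤ ds                            ∎
    where open ≡-Reasoning

  hornerVec : ∀ {r} → Vec ℤ r → List (Letter ρ r) → Vec ℤ r
  hornerVec = foldl (zipWith pushDigit)

  lookup-hornerVec : ∀ {r} (v : Vec ℤ r) w i →
    lookup (hornerVec v w) i ≡ horner (lookup v i) (List.map (λ b → lookup b i) w)
  lookup-hornerVec v w i = trans
    (foldl-fusion (λ v → lookup v i) (λ v b → VecP.lookup-zipWith _ i v b) v w)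
    (sym (ListP.foldl-map _ (λ b → lookup b i) (lookup v i) w))

  decode≡hornerVec : ∀ {r} (a : Letter ρ r) w → decode (a ∷ w) ≡ hornerVec (σ a) w
  decode≡hornerVec a w = trans
    (VecP.tabulate-cong λ i → trans (decodeTrack≡horner a i _) (sym (lookup-hornerVec (σ a) w i)))
    (VecP.tabulate∘lookup (hornerVec (σ a) w))

  ηℤ : ∀ {r} → Term r → ℤ → Letter ρ r → ℤ
  ηℤ t v b = + ρ * v + eval t (digits b)

  eval-step : ∀ {r} (t : Term r) v (b : Letter ρ r) →
    eval t (zipWith pushDigit v b) ≡ ηℤ t (eval t v) b
  eval-step []      []      []      = solve 1 (λ R → con 0ℤ := R :* con 0ℤ :+ con 0ℤ) refl (+ ρ)
  eval-step (k ∷ t) (a ∷ v) (d ∷ b) = begin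
    k * (+ ρ * a + + toℕ d) + eval t (zipWith _ v b)
      ≡⟨ cong (_+_ (k * (+ ρ * a + + toℕ d))) (eval-step t v b) ⟩
    k * (+ ρ * a + + toℕ d) + (+ ρ * eval t v + eval t (digits b))
      ≡⟨ solve 6 (λ R k a d E D → k :* (R :* a :+ d) :+ (R :* E :+ D) := R :* (k :* a :+ E) :+ (k :* d :+ D))
           refl (+ ρ) k a (+ toℕ d) (eval t v) (eval t (digits b)) ⟩
    + ρ * (k * a + eval t v) + (k * + toℕ d + eval t (digits b)) ∎
    where open ≡-Reasoning

  eval-decode : ∀ {r} (t : Term r) a w → eval t (decode (a ∷ w)) ≡ foldl (ηℤ t) (eval t (σ a)) w
  eval-decode t a w = trans (cong (eval t) (decode≡hornerVec a w))
                            (foldl-fusion (eval t) (eval-step t) (σ a) w)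

  ηℤ-≤ : ∀ {r} (t : Term r) {m x} (b : Letter ρ r) → m + norm₊ t ≤ 0ℤ → x ≤ m → ηℤ t x b ≤ m
  ηℤ-≤ t {m} {x} b m+N≤0 x≤m = begin
    + ρ * x + eval t (digits b)   ≤⟨ ℤP.+-mono-≤ (ℤP.*-monoˡ-≤-nonNeg (+ ρ) x≤m) (eval-digits-≤ t b) ⟩
    + ρ * m + + p * norm₊ t       ≡⟨ solve 3 (λ P m N → (con (+ 1) :+ P) :* m :+ P :* N := m :+ P :* (m :+ N))
                                       refl (+ p) m (norm₊ t) ⟩
    m + + p * (m + norm₊ t)       ≤⟨ ℤP.+-monoʳ-≤ m (ℤP.*-monoˡ-≤-nonNeg (+ p) m+N≤0) ⟩
    m + + p * 0ℤ                  ≡⟨ cong (_+_ m) (ℤP.*-zeroʳ (+ p)) ⟩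
    m + 0ℤ                        ≡⟨ ℤP.+-identityʳ m ⟩
    m                             ∎
    where open ℤP.≤-Reasoning

  ηℤ-≥ : ∀ {r} (t : Term r) {n x} (b : Letter ρ r) → 0ℤ ≤ n - norm₋ t → n ≤ x → n ≤ ηℤ t x b
  ηℤ-≥ t {n} {x} b 0≤n-N n≤x = begin
    n                             ≡⟨ sym (ℤP.+-identityʳ n) ⟩
    n + 0ℤ                        ≡⟨ cong (_+_ n) (sym (ℤP.*-zeroʳ (+ p))) ⟩
    n + + p * 0ℤ                  ≤⟨ ℤP.+-monoʳ-≤ n (ℤP.*-monoˡ-≤-nonNeg (+ p) 0≤n-N) ⟩
    n + + p * (n - norm₋ t)       ≡⟨ solve 3 (λ P n N → n :+ P :* (n :+ :- N) := (con (+ 1) :+ P) :* n :+ :- (P :* N))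
                                       refl (+ p) n (norm₋ t) ⟩
    + ρ * n - + p * norm₋ t       ≤⟨ ℤP.+-mono-≤ (ℤP.*-monoˡ-≤-nonNeg (+ ρ) n≤x) (eval-digits-≥ t b) ⟩
    + ρ * x + eval t (digits b)   ∎
    where open ℤP.≤-Reasoning

  module Run {r} (t : Term r) {m n : ℤ} (m<n : m < n) where

    m≤n : m ≤ n
    m≤n = <⇒≤ m<n

    data Tracks : State m n → ℤ → Set where
      exact : ∀ {q} m≤q q≤n → Tracks (val q m≤q q≤n) q
      below : ∀ m≤m m≤n′ {v} → v ≤ m → Tracks (val m m≤m m≤n′) v
      above : ∀ m≤n′ n≤n {v} → n ≤ v → Tracks (val n m≤n′ n≤n) v

    Tracks-clamp : ∀ e → Tracks (clamp m≤n e) e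
    Tracks-clamp e with e ≤? m
    ... | yes e≤m = below _ _ e≤m
    ... | no _ with n ≤? e
    ...   | yes n≤e = above _ _ n≤e
    ...   | no _    = exact _ _

    clamp-below : ∀ {e v} → e ≤ m → v ≤ m → Tracks (clamp m≤n e) v
    clamp-below {e} e≤m v≤m with e ≤? m
    ... | yes _   = below _ _ v≤m
    ... | no e≰m = contradiction e≤m e≰m

    clamp-above : ∀ {e v} → n ≤ e → n ≤ v → Tracks (clamp m≤n e) v
    clamp-above {e} n≤e n≤v with e ≤? m
    ... | yes e≤m = contradiction (ℤP.≤-trans n≤e e≤m) (ℤP.<⇒≱ m<n)
    ... | no _ with n ≤? e
    ...   | yes _   = above _ _ n≤v
    ...   | no n≰e = contradiction n≤e n≰e

    Tracks-step : m + norm₊ t ≤ 0ℤ → 0ℤ ≤ n - norm₋ t →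
      ∀ {s v} b → Tracks s v → Tracks (clamp m≤n (η t s b)) (ηℤ t v b)
    Tracks-step _     _     b (exact _ _)   = Tracks-clamp _
    Tracks-step m+N≤0 _     b (below _ _ v≤m) =
      clamp-below (ηℤ-≤ t b m+N≤0 ℤP.≤-refl) (ηℤ-≤ t b m+N≤0 v≤m)
    Tracks-step _     0≤n-N b (above _ _ n≤v) =
      clamp-above (ηℤ-≥ t b 0≤n-N ℤP.≤-refl) (ηℤ-≥ t b 0≤n-N n≤v)

    Tracks-accept : ∀ ⋈ {c s v} → m < c → c < n → Tracks s v → acceptSt ⋈ c s ⇔ ⟦ ⋈ ⟧ v c
    Tracks-accept ⋈ m<c c<n (exact _ _)     = mk⇔ id id
    Tracks-accept ⋈ m<c c<n (below _ _ v≤m) = ⟦⟧-below ⋈ m<c (ℤP.≤-<-trans v≤m m<c)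
    Tracks-accept ⋈ m<c c<n (above _ _ n≤v) = ⟦⟧-above ⋈ c<n (ℤP.<-≤-trans c<n n≤v)

  represents : ∀ {r} (t : Term r) ⋈ c {m n} (m<n : m < n) → Small t c m → Large t c n →
    Represents (automaton ρ t ⋈ c m n (<⇒≤ m<n)) (λ a → ⟦ ⋈ ⟧ (eval t a) c)
  represents t ⋈ c {m} {n} m<n small large (a ∷ w) =
    subst (λ x → acceptSt ⋈ c final ⇔ ⟦ ⋈ ⟧ x c) (sym (eval-decode t a w))
      (Tracks-accept ⋈ (small⇒<c t small) (large⇒c< t large) run)
    where
    open Run t m<n
    final : State m n
    final = foldl (λ s b → clamp m≤n (η t s b)) (clamp m≤n (eval t (σ a))) w
    run : Tracks final (foldl (ηℤ t) (eval t (σ a)) w)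
    run = foldl-simulation Tracks (Tracks-step (small⇒+norm₊≤0 t small) (large⇒0≤-norm₋ t large)) w
            (Tracks-clamp (eval t (σ a)))

val-cong : ∀ {m n q q′} {m≤q q≤n m≤q′ q′≤n} → q ≡ q′ → val {m} {n} q m≤q q≤n ≡ val q′ m≤q′ q′≤n
val-cong refl = cong₂ (val _) (ℤP.≤-irrelevant _ _) (ℤP.≤-irrelevant _ _)

module _ {m n : ℤ} (m≤n : m ≤ n) where

  private
    width : ℕ
    width = ∣ n - m ∣

  +width : + width ≡ n - m
  +width = ℤP.0≤i⇒+∣i∣≡i (ℤP.i≤j⇒0≤j-i m≤n)

  ∣q-m∣<1+width : ∀ {q} → m ≤ q → q ≤ n → ∣ q - m ∣ ℕ.< suc width
  ∣q-m∣<1+width {q} m≤q q≤n = s≤s (ℤP.drop‿+≤+ (subst₂ _≤_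
    (sym (ℤP.0≤i⇒+∣i∣≡i (ℤP.i≤j⇒0≤j-i m≤q))) (sym +width) (ℤP.+-monoˡ-≤ (- m) q≤n)))

  m+i≤n : (i : Fin (suc width)) → m + + toℕ i ≤ n
  m+i≤n i = subst (m + + toℕ i ≤_) (solve 2 (λ m n → m :+ (n :+ :- m) := n) refl m n)
    (ℤP.+-monoʳ-≤ m (subst (+ toℕ i ≤_) +width (+≤+ (FinP.toℕ≤pred[n] i))))

  State↔Fin : State m n ↔ Fin (suc (suc width))
  State↔Fin = mk↔ₛ′ to from to∘from from∘to
    where
    to : State m n → Fin (suc (suc width))
    to qInit           = fzero
    to (val q m≤q q≤n) = fsuc (fromℕ< (∣q-m∣<1+width m≤q q≤n))

    from : Fin (suc (suc width)) → State m n
    from fzero    = qInit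
    from (fsuc i) = val (m + + toℕ i) (ℤP.i≤i+j m (+ toℕ i)) (m+i≤n i)

    to∘from : ∀ i → to (from i) ≡ i
    to∘from fzero    = refl
    to∘from (fsuc i) = cong fsuc (trans
      (FinP.fromℕ<-cong _ _ (cong ∣_∣ (solve 2 (λ m j → m :+ j :+ :- m := j) refl m (+ toℕ i)))
                        _ (FinP.toℕ<n i))
      (FinP.fromℕ<-toℕ i _))

    from∘to : ∀ s → from (to s) ≡ s
    from∘to qInit           = refl
    from∘to (val q m≤q q≤n) = val-cong (begin
      m + + toℕ (fromℕ< (∣q-m∣<1+width m≤q q≤n))  ≡⟨ cong (λ k → m + + k) (FinP.toℕ-fromℕ< _) ⟩
      m + + ∣ q - m ∣                              ≡⟨ cong (_+_ m) (ℤP.0≤i⇒+∣i∣≡i (ℤP.i≤j⇒0≤j-i m≤q)) ⟩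
      m + (q - m)                                  ≡⟨ solve 2 (λ m q → m :+ (q :+ :- m) := q) refl m q ⟩
      q                                            ∎)
      where open ≡-Reasoning

  ∣2+n-m∣≡2+width : ∣ + 2 + n - m ∣ ≡ suc (suc width)
  ∣2+n-m∣≡2+width = cong ∣_∣ (begin
    + 2 + n - m       ≡⟨ ℤP.+-assoc (+ 2) n (- m) ⟩
    + 2 + (n - m)     ≡⟨ cong (_+_ (+ 2)) (sym +width) ⟩
    + 2 + + width     ≡⟨ sym (ℤP.pos-+ 2 width) ⟩
    + (2 ℕ.+ width)   ∎)
    where open ≡-Reasoning

  State↔Fin∣2+n-m∣ : State m n ↔ Fin ∣ + 2 + n - m ∣
  State↔Fin∣2+n-m∣ = subst (λ k → State m n ↔ Fin k) (sym ∣2+n-m∣≡2+width) State↔Fin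

-- Nonzero coefficients are not needed, and ρ ≥ 1 would suffice.
lemma3p6 : (ρ : ℕ) → ρ ≥ 2 → (r : ℕ) (t : Term r) → All (λ k → k ≢ 0ℤ) t →
    (c : ℤ) (⋈ : Cmp) (m n : ℤ) (m<n : m < n) → Small t c m → Large t c n →
    Represents (automaton ρ t ⋈ c m n (<⇒≤ m<n)) (λ a → ⟦ ⋈ ⟧ (eval t a) c)
      × (DWA.Q (automaton ρ t ⋈ c m n (<⇒≤ m<n)) ↔ Fin ∣ + 2 + n - m ∣)
lemma3p6 (suc p) _ r t _ c ⋈ m n m<n small large =
  represents p t ⋈ c m<n small large , State↔Fin∣2+n-m∣ (<⇒≤ m<n)
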